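{- Let $e$ be a planar circular electrical network with $n$ boundary vertices and response matrix $M_R(e)=(x_{ij})$. Let $\widetilde\Omega_n(e)$ be the $n\times(2n-2)$ matrix whose $i$-th row is the coordinate vector, with respect to the basis $w_1,\dots,w_{2n-2}$ of $V$, of the $i$-th row of $\Omega_n(e)$. Then $$\widetilde\Omega_n(e)\,\Lambda_{2n-2}\,\widetilde\Omega_n(e)^T=0.$$ That is, the row space of $\widetilde\Omega_n(e)$ (which has dimension $n-1$) is a Lagrangian subspace for the symplectic form $\Lambda_{2n-2}$, and hence defines a point of the Lagrangian Grassmannian $\mathrm{LG}(n-1,V)$.
   Context: $M_R(e)$ is the response matrix (boundary potentials to boundary currents by Kirchhoff's laws). It is symmetric with zero row sums. $\Omega_n(e)$ is the $n\times2n$ matrix with entries - $\Omega_{i,2j-1}=(-1)^{i+j}x_{ij}$; - in even columns, row $1$ has $1$ in column $2$ and $(-1)^n$ in column $2n$; - in even columns, row $i\ge 2$ has $1$ in columns $2i-2$ and $2i$; - all other even-column entries are $0$. Its rows lie in $$V=\Big\{v\in\mathbb{C}^{2n}:\sum_{i=1}^n(-1)^iv_{2i}=0,\ \sum_{i=1}^n(-1)^iv_{2i-1}=0\Big\},$$ which has basis $w_k=e_k+e_{k+2}$, $k=1,\dots,2n-2$, where $e_k$ are the standard basis vectors of $\mathbb{C}^{2n}$. $\Lambda_{2n-2}$ is the $(2n-2)\times(2n-2)$ skew-symmetric tridiagonal matrix with $(\Lambda_{2n-2})_{k,k+1}=(-1)^{k+1}$, $(\Lambda_{2n-2})_{k+1,k}=(-1)^k$,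 and all other entries $0$. Its first rows are $(0,1,0,0,\dots)$, $(-1,0,-1,0,\dots)$, $(0,1,0,1,\dots)$. It is non-degenerate and defines a symplectic form $\omega(w_i,w_j)=(\Lambda_{2n-2})_{ij}$ on $V$. -}

module Defs where

open import Level using (_⊔_)
open import Data.Nat using (ℕ; zero; suc; _∸_; _≡ᵇ_)
import Data.Nat as ℕ
open import Data.Bool using (Bool; true; false; if_then_else_)
open import Data.Fin using (Fin; toℕ; quotRem)
open import Data.Fin.Patterns using (0F; 1F)
open import Data.Product using (_,_)
open import Algebra.Bundles using (CommutativeRing)
import Algebra.Properties.Monoid.Sum as MonoidSum

-- All definitions are over an arbitrary commutative ring R (the paper works
-- over ℂ with real entries x_ij).
-- Indices are 0-based in Agda: Agda row i / column c / basis index k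
-- correspond to the paper's i+1 / c+1 / k+1.

module _ {c ℓ} (R : CommutativeRing c ℓ) where
  open CommutativeRing R
  open MonoidSum +-monoid using (sum)

  Matrix : ℕ → ℕ → Set c
  Matrix a b = Fin a → Fin b → Carrier

  sgn : ℕ → Carrier
  sgn zero    = 1#
  sgn (suc k) = - sgn k

  ind : Bool → Carrier
  ind b = if b then 1# else 0#

  _⊗_ : ∀ {a b d} → Matrix a b → Matrix b d → Matrix a d
  (A ⊗ B) i j = sum (λ k → A i k * B k j)

  _ᵀ : ∀ {a b} → Matrix a b → Matrix b a
  (A ᵀ) i j = A j i

  -- the matrix x is symmetric with zero row sums
  -- (the properties of a response matrix M_R(e) = (x_ij))
  IsSymmetric : ∀ {n} → Matrix n n → Set ℓ
  IsSymmetric x = ∀ i j → x i j ≈ x j i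

  HasZeroRowSums : ∀ {n} → Matrix n n → Set ℓ
  HasZeroRowSums x = ∀ i → sum (x i) ≈ 0#

  -- even-column entries of Ω_n: paper row i+1, paper column 2(j+1)
  ΩEven : (n : ℕ) → Fin n → Fin n → Carrier
  ΩEven n i j with toℕ i
  ... | zero  = ind (toℕ j ≡ᵇ 0) + ind (toℕ j ≡ᵇ (n ∸ 1)) * sgn n
  ... | suc _ = ind (suc (toℕ j) ≡ᵇ toℕ i) + ind (toℕ j ≡ᵇ toℕ i)

  -- Ω_n(e): n × 2n matrix; the 2n columns are indexed by Fin (n * 2),
  -- where 0-based column 2j+r  (r ∈ {0,1}) is paper column 2(j+1)-1 if r = 0
  -- and paper column 2(j+1) if r = 1.
  Ω : (n : ℕ) → Matrix n n → Matrix n (n ℕ.* 2)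
  Ω n x i col with quotRem {n} 2 col
  ... | 0F , j = sgn (toℕ i ℕ.+ toℕ j) * x i j
  ... | 1F , j = ΩEven n i j

  -- basis vectors w_k = e_k + e_{k+2} of V ⊆ R^{2n}, n = suc m, k = 1..2m
  -- (row k of this matrix is w_{k+1}, 0-based)
  W : (m : ℕ) → Matrix (2 ℕ.* m) (suc m ℕ.* 2)
  W m k col = ind (toℕ col ≡ᵇ toℕ k) + ind (toℕ col ≡ᵇ (toℕ k ℕ.+ 2))

  -- Λ_{2n-2}, n = suc m: (Λ)_{k,k+1} = (-1)^{k+1}, (Λ)_{k+1,k} = (-1)^k (1-based)
  Λ : (m : ℕ) → Matrix (2 ℕ.* m) (2 ℕ.* m)
  Λ m a b =
    if toℕ b ≡ᵇ suc (toℕ a) then sgn (toℕ a)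
    else (if toℕ a ≡ᵇ suc (toℕ b) then sgn (toℕ a) else 0#)

  -- Ωt is the matrix whose i-th row is the coordinate vector, w.r.t. the
  -- basis w_1,…,w_{2n-2}, of the i-th row of Ω_n(e):  Ω = Ωt · W
  IsCoordinateMatrix : (m : ℕ) → Matrix (suc m) (suc m) → Matrix (suc m) (2 ℕ.* m) → Set ℓ
  IsCoordinateMatrix m x Ωt = ∀ i col → Ω (suc m) x i col ≈ (Ωt ⊗ W m) i col

{-# OPTIONS --safe #-}
-- Λ = B - Bᵀ with B_{k,k+1} = (-1)^k, so pairing the basis indices as
-- (2j, 2j+1) turns the form into
--   ω(u, v) = Σ_j (a_j(u) o_j(v) - a_j(v) o_j(u)),
--   o_j(u) = u_{2j+1},  a_j(u) = u_{2j} + u_{2j+2}   (indices from 0, u_{2n-2} = 0).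
-- Since w_k = e_k + e_{k+2}, for the coordinates u of row i of Ω_n the sum a_j(u)
-- is the entry (-1)^{i+j+1} x_{i,j+1} of Ω_n, while the o_j(u) are the alternating
-- partial sums of the even-numbered columns of Ω_n: (-1)^j for i = 0 and the
-- indicator of j = i-1 for i ≥ 1.  Hence Σ_j a_j(row i) o_j(row i') equals
-- (-1)^{i+i'} x_{ii'} (for i' = 0 because of the zero row sums), which is
-- symmetric in i and i'.
module Submission where

open import Defs
open import Data.Nat using (ℕ; suc; _*_)
open import Algebra.Bundles using (CommutativeRing)

import Data.Nat as ℕ
open import Data.Nat using (zero; _≤_; _<_; z≤n; s≤s; _≡ᵇ_)
import Data.Nat.Properties as ℕₚ
open import Data.Bool using (if_then_else_)
open import Data.Fin using (Fin; zero; suc; toℕ; fromℕ<; combine; quotRem)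
open import Data.Fin.Properties
  using (toℕ-fromℕ<; toℕ-combine; remQuot-combine)
open import Data.Fin.Patterns using (0F; 1F)
open import Data.Product using (_,_; swap)
open import Data.Maybe using (nothing)
open import Relation.Binary.PropositionalEquality as ≡ using (_≡_)
open import Tactic.RingSolver.Core.AlmostCommutativeRing using (fromCommutativeRing)
open import Tactic.RingSolver.Core.Expression using (⊝_) renaming (_⊕_ to _:+_; _⊗_ to _:*_)
import Tactic.RingSolver.NonReflective as RingSolver
import Algebra.Properties.Monoid.Sum as MonoidSum
import Algebra.Properties.Ring as RingProperties
import Algebra.Properties.CommutativeSemigroup as CommutativeSemigroupProperties
import Relation.Binary.Reasoning.Setoid as SetoidReasoning

≡ᵇ-sym : ∀ a b → (a ≡ᵇ b) ≡ (b ≡ᵇ a)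
≡ᵇ-sym zero    zero    = ≡.refl
≡ᵇ-sym zero    (suc b) = ≡.refl
≡ᵇ-sym (suc a) zero    = ≡.refl
≡ᵇ-sym (suc a) (suc b) = ≡ᵇ-sym a b

fromFin : ∀ {p n} (P : ℕ → Set p) → (∀ (k : Fin n) → P (toℕ k)) → ∀ k → k < n → P k
fromFin P h k k<n = ≡.subst P (toℕ-fromℕ< k<n) (h (fromℕ< k<n))

toℕ-combine-0F : ∀ {m} (j : Fin m) → toℕ (combine {n = 2} j 0F) ≡ 2 * toℕ j
toℕ-combine-0F j = ≡.trans (toℕ-combine j 0F) (ℕₚ.+-identityʳ _)

toℕ-combine-1F : ∀ {m} (j : Fin m) → toℕ (combine {n = 2} j 1F) ≡ suc (2 * toℕ j)
toℕ-combine-1F j = ≡.trans (toℕ-combine j 1F) (ℕₚ.+-comm _ 1)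

quotRem-combine : ∀ {m} (j : Fin m) r → quotRem {m} 2 (combine j r) ≡ (r , j)
quotRem-combine j r = ≡.cong swap (remQuot-combine j r)

module _ {c ℓ} (R : CommutativeRing c ℓ) where
  open CommutativeRing R hiding (zero) renaming (_*_ to _·_)
  open MonoidSum +-monoid using (sum)
  open RingProperties ring
    using (-‿distribˡ-*; -‿distribʳ-*; -‿involutive; -0#≈0#; -‿+-comm; +-cancelʳ; +-inverseʳ-unique)
  open CommutativeSemigroupProperties *-commutativeSemigroup using (xy∙z≈xz∙y)
  open CommutativeSemigroupProperties +-commutativeSemigroup using () renaming (interchange to +-interchange)
  open RingSolver (fromCommutativeRing R (λ _ → nothing)) using (solve; _⊜_)
  open SetoidReasoning setoid

  ∑ℕ : ℕ → (ℕ → Carrier) → Carrier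
  ∑ℕ zero    f = 0#
  ∑ℕ (suc n) f = f 0 + ∑ℕ n (λ k → f (suc k))

  sum≈∑ℕ : ∀ {N} (F : Fin N → Carrier) G → (∀ k → F k ≈ G (toℕ k)) → sum F ≈ ∑ℕ N G
  sum≈∑ℕ {zero}  F G F≈G = refl
  sum≈∑ℕ {suc N} F G F≈G =
    +-cong (F≈G zero) (sum≈∑ℕ (λ k → F (suc k)) (λ k → G (suc k)) (λ k → F≈G (suc k)))

  ∑ℕ-cong : ∀ n {f g} → (∀ k → k < n → f k ≈ g k) → ∑ℕ n f ≈ ∑ℕ n g
  ∑ℕ-cong zero    f≈g = refl
  ∑ℕ-cong (suc n) f≈g = +-cong (f≈g 0 (s≤s z≤n)) (∑ℕ-cong n (λ k k<n → f≈g (suc k) (s≤s k<n)))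

  ∑ℕ-zero : ∀ n {f} → (∀ k → f k ≈ 0#) → ∑ℕ n f ≈ 0#
  ∑ℕ-zero zero    f≈0 = refl
  ∑ℕ-zero (suc n) f≈0 = trans (+-cong (f≈0 0) (∑ℕ-zero n (λ k → f≈0 (suc k)))) (+-identityʳ 0#)

  ∑ℕ-snoc : ∀ n f → ∑ℕ (suc n) f ≈ ∑ℕ n f + f n
  ∑ℕ-snoc zero    f = +-comm _ _
  ∑ℕ-snoc (suc n) f = trans (+-congˡ (∑ℕ-snoc n _)) (sym (+-assoc _ _ _))

  ∑ℕ-distrib-+ : ∀ n f g → ∑ℕ n (λ k → f k + g k) ≈ ∑ℕ n f + ∑ℕ n g
  ∑ℕ-distrib-+ zero    f g = sym (+-identityʳ 0#)
  ∑ℕ-distrib-+ (suc n) f g = trans (+-congˡ (∑ℕ-distrib-+ n _ _)) (+-interchange _ _ _ _)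

  ∑ℕ-*ˡ : ∀ n a f → ∑ℕ n (λ k → a · f k) ≈ a · ∑ℕ n f
  ∑ℕ-*ˡ zero    a f = sym (zeroʳ a)
  ∑ℕ-*ˡ (suc n) a f = trans (+-congˡ (∑ℕ-*ˡ n a _)) (sym (distribˡ a _ _))

  ∑ℕ-neg : ∀ n f → ∑ℕ n (λ k → - f k) ≈ - ∑ℕ n f
  ∑ℕ-neg zero    f = sym -0#≈0#
  ∑ℕ-neg (suc n) f = trans (+-congˡ (∑ℕ-neg n _)) (-‿+-comm _ _)

  ∑ℕ-sub : ∀ n f g → ∑ℕ n (λ k → f k - g k) ≈ ∑ℕ n f - ∑ℕ n g
  ∑ℕ-sub n f g = trans (∑ℕ-distrib-+ n f _) (+-congˡ (∑ℕ-neg n g))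

  ∑ℕ-evenOdd : ∀ m f → ∑ℕ (2 * m) f ≈ ∑ℕ m (λ j → f (2 * j) + f (suc (2 * j)))
  ∑ℕ-evenOdd zero    f = refl
  ∑ℕ-evenOdd (suc m) f = begin
    ∑ℕ (2 * suc m) f
      ≡⟨ ≡.cong (λ n → ∑ℕ n f) (ℕₚ.*-suc 2 m) ⟩
    f 0 + (f 1 + ∑ℕ (2 * m) (λ k → f (suc (suc k))))
      ≈⟨ +-assoc _ _ _ ⟨
    (f 0 + f 1) + ∑ℕ (2 * m) (λ k → f (suc (suc k)))
      ≈⟨ +-congˡ (∑ℕ-evenOdd m _) ⟩
    (f 0 + f 1) + ∑ℕ m (λ j → f (suc (suc (2 * j))) + f (suc (suc (suc (2 * j)))))
      ≈⟨ +-congˡ (∑ℕ-cong m (λ j _ →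
           reflexive (≡.cong (λ n → f n + f (suc n)) (≡.sym (ℕₚ.*-suc 2 j))))) ⟩
    ∑ℕ (suc m) (λ j → f (2 * j) + f (suc (2 * j))) ∎

  shift : ℕ → (ℕ → Carrier) → ℕ → Carrier
  shift zero    f       = f
  shift (suc d) f zero    = 0#
  shift (suc d) f (suc k) = shift d f k

  shift₂-odd : ∀ f j → shift 2 f (suc (2 * j)) ≡ shift 1 (λ k → f (suc (2 * k))) j
  shift₂-odd f zero    = ≡.refl
  shift₂-odd f (suc j) = ≡.cong (λ n → shift 2 f (suc n)) (ℕₚ.*-suc 2 j)

  ∑ℕ-δ : ∀ N d c {f} → (∀ k → N ≤ k → f k ≈ 0#) →
         ∑ℕ N (λ k → f k · ind R (c ≡ᵇ d ℕ.+ k)) ≈ shift d f c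
  ∑ℕ-δ zero    zero    c       f≥N = sym (f≥N c z≤n)
  ∑ℕ-δ (suc N) zero    zero    f≥N =
    trans (+-cong (*-identityʳ _) (∑ℕ-zero N (λ _ → zeroʳ _))) (+-identityʳ _)
  ∑ℕ-δ (suc N) zero    (suc c) f≥N =
    trans (+-cong (zeroʳ _) (∑ℕ-δ N zero c (λ k N≤k → f≥N (suc k) (s≤s N≤k)))) (+-identityˡ _)
  ∑ℕ-δ N       (suc d) zero    f≥N = ∑ℕ-zero N (λ _ → zeroʳ _)
  ∑ℕ-δ N       (suc d) (suc c) f≥N = ∑ℕ-δ N d c f≥N

  ∑ℕ-shift₁ : ∀ N (g : ℕ → Carrier) {v : ℕ → Carrier} → (∀ k → N ≤ k → v k ≈ 0#) →
              ∑ℕ N (λ k → shift 1 g k · v k) ≈ ∑ℕ N (λ k → g k · v (suc k))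
  ∑ℕ-shift₁ zero    g     v≥N = refl
  ∑ℕ-shift₁ (suc N) g {v} v≥N = begin
    0# · v 0 + ∑ℕ N (λ k → g k · v (suc k))
      ≈⟨ trans (+-congʳ (zeroˡ _)) (+-identityˡ _) ⟩
    ∑ℕ N (λ k → g k · v (suc k))
      ≈⟨ +-identityʳ _ ⟨
    ∑ℕ N (λ k → g k · v (suc k)) + 0#
      ≈⟨ +-congˡ (trans (*-congˡ (v≥N (suc N) ℕₚ.≤-refl)) (zeroʳ _)) ⟨
    ∑ℕ N (λ k → g k · v (suc k)) + g N · v (suc N)
      ≈⟨ ∑ℕ-snoc N _ ⟨
    ∑ℕ (suc N) (λ k → g k · v (suc k)) ∎

  consecutive-sums-agree : ∀ {M f g} → (∀ j → j < M → f j + shift 1 f j ≈ g j + shift 1 g j) →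
                           ∀ j → j < M → f j ≈ g j
  consecutive-sums-agree h zero    0<M   = +-cancelʳ 0# _ _ (h zero 0<M)
  consecutive-sums-agree h (suc j) 1+j<M = +-cancelʳ _ _ _
    (trans (+-congˡ (sym (consecutive-sums-agree h j (ℕₚ.<⇒≤ 1+j<M)))) (h (suc j) 1+j<M))

  pad : ∀ {N} → (Fin N → Carrier) → ℕ → Carrier
  pad {zero}  u k       = 0#
  pad {suc N} u zero    = u zero
  pad {suc N} u (suc k) = pad (λ i → u (suc i)) k

  pad-toℕ : ∀ {N} (u : Fin N → Carrier) k → pad u (toℕ k) ≡ u k
  pad-toℕ u zero    = ≡.refl
  pad-toℕ u (suc k) = pad-toℕ (λ i → u (suc i)) k

  pad-vanishes : ∀ {N} (u : Fin N → Carrier) k → N ≤ k → pad u k ≈ 0#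
  pad-vanishes {zero}  u k       _         = refl
  pad-vanishes {suc N} u (suc k) (s≤s N≤k) = pad-vanishes (λ i → u (suc i)) k N≤k

  ind-< : ∀ {a b} → a < b → ind R (a ≡ᵇ b) ≡ 0#
  ind-< {zero}  {suc b} _       = ≡.refl
  ind-< {suc a} {suc b} (s≤s p) = ind-< p

  -x·-y≈x·y : ∀ x y → (- x) · (- y) ≈ x · y
  -x·-y≈x·y x y = trans (sym (-‿distribˡ-* x (- y)))
                        (trans (-‿cong (sym (-‿distribʳ-* x y))) (-‿involutive _))

  sgn² : ∀ a → sgn R a · sgn R a ≈ 1#
  sgn² zero    = *-identityˡ 1#
  sgn² (suc a) = trans (-x·-y≈x·y _ _) (sgn² a)

  sgn-+-suc-· : ∀ a j → sgn R (a ℕ.+ suc j) · sgn R j ≈ - sgn R a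
  sgn-+-suc-· zero    j = trans (sym (-‿distribˡ-* _ _)) (-‿cong (sgn² j))
  sgn-+-suc-· (suc a) j = trans (sym (-‿distribˡ-* _ _)) (-‿cong (sgn-+-suc-· a j))

  sgn-even : ∀ j → sgn R (2 * j) ≈ 1#
  sgn-even zero    = refl
  sgn-even (suc j) = trans (reflexive (≡.cong (sgn R) (ℕₚ.*-suc 2 j)))
                           (trans (-‿involutive _) (sgn-even j))

  signed : (ℕ → Carrier) → ℕ → Carrier
  signed u k = sgn R k · u k

  signed-even : ∀ u j → signed u (2 * j) ≈ u (2 * j)
  signed-even u j = trans (*-congʳ (sgn-even j)) (*-identityˡ _)

  signed-even₂ : ∀ u j → signed u (suc (suc (2 * j))) ≈ u (suc (suc (2 * j)))
  signed-even₂ u j = trans (*-congʳ (trans (-‿involutive _) (sgn-even j))) (*-identityˡ _)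

  signed-odd-· : ∀ u j y → signed u (suc (2 * j)) · y ≈ - (u (suc (2 * j)) · y)
  signed-odd-· u j y = trans (*-congʳ (trans (sym (-‿distribˡ-* _ _))
                                            (-‿cong (trans (*-congʳ (sgn-even j)) (*-identityˡ _)))))
                             (sym (-‿distribˡ-* _ _))

  0·s+0·s≈0 : ∀ s → 0# · s + 0# · s ≈ 0#
  0·s+0·s≈0 s = trans (+-cong (zeroˡ s) (zeroˡ s)) (+-identityʳ 0#)

  Λ-split : ∀ a b s → (if b ≡ᵇ suc a then s else (if a ≡ᵇ suc b then s else 0#))
                      ≈ ind R (b ≡ᵇ 1 ℕ.+ a) · s + ind R (suc b ≡ᵇ 0 ℕ.+ a) · s
  Λ-split zero          zero          s = sym (0·s+0·s≈0 s)
  Λ-split zero          (suc zero)    s = sym (trans (+-cong (*-identityˡ s) (zeroˡ s)) (+-identityʳ s))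
  Λ-split zero          (suc (suc b)) s = sym (0·s+0·s≈0 s)
  Λ-split (suc zero)    zero          s = sym (trans (+-cong (zeroˡ s) (*-identityˡ s)) (+-identityˡ s))
  Λ-split (suc (suc a)) zero          s = sym (0·s+0·s≈0 s)
  Λ-split (suc a)       (suc b)       s = Λ-split a b s

  ⊗Λ : ∀ {a m} (A : Matrix R a (2 * m)) i b →
       _⊗_ R A (Λ R m) i b ≈ shift 1 (signed (pad (A i))) (toℕ b) + signed (pad (A i)) (suc (toℕ b))
  ⊗Λ {m = m} A i b = begin
    sum (λ a → A i a · Λ R m a b)
      ≈⟨ sum≈∑ℕ _ _ (λ a → trans (*-cong (reflexive (≡.sym (pad-toℕ (A i) a))) (Λ-split (toℕ a) b′ _))
                                  (distribute (pad (A i) (toℕ a)) _ _ (sgn R (toℕ a)))) ⟩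
    ∑ℕ (2 * m) (λ a → g a · ind R (b′ ≡ᵇ 1 ℕ.+ a) + g a · ind R (suc b′ ≡ᵇ 0 ℕ.+ a))
      ≈⟨ ∑ℕ-distrib-+ (2 * m) _ _ ⟩
    ∑ℕ (2 * m) (λ a → g a · ind R (b′ ≡ᵇ 1 ℕ.+ a))
      + ∑ℕ (2 * m) (λ a → g a · ind R (suc b′ ≡ᵇ 0 ℕ.+ a))
      ≈⟨ +-cong (∑ℕ-δ _ 1 b′ g-vanishes) (∑ℕ-δ _ 0 (suc b′) g-vanishes) ⟩
    shift 1 g b′ + g (suc b′) ∎
    where
    b′ = toℕ b
    g = signed (pad (A i))
    g-vanishes : ∀ k → 2 * m ≤ k → g k ≈ 0#
    g-vanishes k p = trans (*-congˡ (pad-vanishes (A i) k p)) (zeroʳ _)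
    distribute : ∀ u δ δ′ s → u · (δ · s + δ′ · s) ≈ (s · u) · δ + (s · u) · δ′
    distribute = solve 4 (λ u δ δ′ s → (u :* (δ :* s :+ δ′ :* s)) ⊜ ((s :* u) :* δ :+ (s :* u) :* δ′)) refl

  Λ-form-adjacent : ∀ {a b m} (A : Matrix R a (2 * m)) (B : Matrix R b (2 * m)) i j →
    _⊗_ R (_⊗_ R A (Λ R m)) (_ᵀ R B) i j
      ≈ ∑ℕ (2 * m) (λ k → signed (pad (A i)) k · pad (B j) (suc k) + signed (pad (A i)) (suc k) · pad (B j) k)
  Λ-form-adjacent {m = m} A B i j = begin
    sum (λ k → _⊗_ R A (Λ R m) i k · B j k)
      ≈⟨ sum≈∑ℕ _ _ (λ k → *-cong (⊗Λ {m = m} A i k) (reflexive (≡.sym (pad-toℕ (B j) k)))) ⟩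
    ∑ℕ N (λ k → (shift 1 g k + g (suc k)) · V k)
      ≈⟨ ∑ℕ-cong N (λ k _ → distribʳ _ _ _) ⟩
    ∑ℕ N (λ k → shift 1 g k · V k + g (suc k) · V k)
      ≈⟨ ∑ℕ-distrib-+ N _ _ ⟩
    ∑ℕ N (λ k → shift 1 g k · V k) + ∑ℕ N (λ k → g (suc k) · V k)
      ≈⟨ +-congʳ (∑ℕ-shift₁ N g (pad-vanishes (B j))) ⟩
    ∑ℕ N (λ k → g k · V (suc k)) + ∑ℕ N (λ k → g (suc k) · V k)
      ≈⟨ ∑ℕ-distrib-+ N _ _ ⟨
    ∑ℕ N (λ k → g k · V (suc k) + g (suc k) · V k) ∎
    where
    N = 2 * m
    V = pad (B j)
    g = signed (pad (A i))

  evenSum : (ℕ → Carrier) → ℕ → Carrier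
  evenSum u j = u (2 * j) + u (suc (suc (2 * j)))

  pairedForm : ℕ → (ℕ → Carrier) → (ℕ → Carrier) → Carrier
  pairedForm m u v = ∑ℕ m (λ j → evenSum u j · v (suc (2 * j)) - evenSum v j · u (suc (2 * j)))

  Λ-form : ∀ {a b m} (A : Matrix R a (2 * m)) (B : Matrix R b (2 * m)) i j →
           _⊗_ R (_⊗_ R A (Λ R m)) (_ᵀ R B) i j ≈ pairedForm m (pad (A i)) (pad (B j))
  Λ-form {m = m} A B i j = begin
    _⊗_ R (_⊗_ R A (Λ R m)) (_ᵀ R B) i j
      ≈⟨ Λ-form-adjacent {m = m} A B i j ⟩
    ∑ℕ (2 * m) (λ k → g k · V (suc k) + g (suc k) · V k)
      ≈⟨ ∑ℕ-evenOdd m _ ⟩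
    ∑ℕ m (λ k → (g (2 * k) · V (suc (2 * k)) + g (suc (2 * k)) · V (2 * k))
              + (g (suc (2 * k)) · V (suc (suc (2 * k))) + g (suc (suc (2 * k))) · V (suc (2 * k))))
      ≈⟨ ∑ℕ-cong m (λ k _ → trans (unsign k) (regroup _ _ _ _ _ _)) ⟩
    pairedForm m U V ∎
    where
    U = pad (A i)
    V = pad (B j)
    g = signed U
    unsign : ∀ k → (g (2 * k) · V (suc (2 * k)) + g (suc (2 * k)) · V (2 * k))
                   + (g (suc (2 * k)) · V (suc (suc (2 * k))) + g (suc (suc (2 * k))) · V (suc (2 * k)))
                 ≈ (U (2 * k) · V (suc (2 * k)) + - (U (suc (2 * k)) · V (2 * k)))
                   + (- (U (suc (2 * k)) · V (suc (suc (2 * k)))) + U (suc (suc (2 * k))) · V (suc (2 * k)))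
    unsign k = +-cong (+-cong (*-congʳ (signed-even U k)) (signed-odd-· U k _))
                      (+-cong (signed-odd-· U k _) (*-congʳ (signed-even₂ U k)))
    regroup : ∀ a b e a′ b′ e′ → (a · b′ + - (b · a′)) + (- (b · e′) + e · b′)
                                 ≈ (a + e) · b′ - (a′ + e′) · b
    regroup = solve 6 (λ a b e a′ b′ e′ →
      ((a :* b′ :+ ⊝ (b :* a′)) :+ (⊝ (b :* e′) :+ e :* b′))
        ⊜ ((a :+ e) :* b′ :+ ⊝ ((a′ :+ e′) :* b))) refl

  module RowCoordinates {m} (x : Matrix R (suc m) (suc m)) (Ωt : Matrix R (suc m) (2 * m))
                        (coord : IsCoordinateMatrix R m x Ωt) where

    row : Fin (suc m) → ℕ → Carrier
    row i = pad (Ωt i)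

    coordinates : ∀ i col → Ω R (suc m) x i col ≈ row i (toℕ col) + shift 2 (row i) (toℕ col)
    coordinates i col = begin
      Ω R (suc m) x i col
        ≈⟨ coord i col ⟩
      sum (λ k → Ωt i k · W R m k col)
        ≈⟨ sum≈∑ℕ _ _ (λ k → trans (*-cong (reflexive (≡.sym (pad-toℕ (Ωt i) k))) (W-entry k))
                                   (distribˡ _ _ _)) ⟩
      ∑ℕ (2 * m) (λ k → row i k · ind R (c′ ≡ᵇ 0 ℕ.+ k) + row i k · ind R (c′ ≡ᵇ 2 ℕ.+ k))
        ≈⟨ ∑ℕ-distrib-+ (2 * m) _ _ ⟩
      ∑ℕ (2 * m) (λ k → row i k · ind R (c′ ≡ᵇ 0 ℕ.+ k))
        + ∑ℕ (2 * m) (λ k → row i k · ind R (c′ ≡ᵇ 2 ℕ.+ k))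
        ≈⟨ +-cong (∑ℕ-δ _ 0 c′ (pad-vanishes (Ωt i))) (∑ℕ-δ _ 2 c′ (pad-vanishes (Ωt i))) ⟩
      row i c′ + shift 2 (row i) c′ ∎
      where
      c′ = toℕ col
      W-entry : ∀ k → W R m k col ≈ ind R (c′ ≡ᵇ toℕ k) + ind R (c′ ≡ᵇ 2 ℕ.+ toℕ k)
      W-entry k = reflexive (≡.cong (λ n → ind R (c′ ≡ᵇ toℕ k) + ind R (c′ ≡ᵇ n)) (ℕₚ.+-comm (toℕ k) 2))

    signedEntry : Fin (suc m) → ℕ → Carrier
    signedEntry i j = sgn R (toℕ i ℕ.+ j) · pad (x i) j

    signedEntry-coordinates : ∀ i (j : Fin (suc m)) →
                   signedEntry i (toℕ j) ≈ row i (2 * toℕ j) + shift 2 (row i) (2 * toℕ j)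
    signedEntry-coordinates i j = begin
      signedEntry i (toℕ j)
        ≡⟨ ≡.cong (_ ·_) (pad-toℕ (x i) j) ⟩
      sgn R (toℕ i ℕ.+ toℕ j) · x i j
        ≡⟨ Ω-at ⟨
      Ω R (suc m) x i (combine j 0F)
        ≈⟨ coordinates i _ ⟩
      row i (toℕ (combine j 0F)) + shift 2 (row i) (toℕ (combine j 0F))
        ≡⟨ ≡.cong (λ n → row i n + shift 2 (row i) n) (toℕ-combine-0F j) ⟩
      row i (2 * toℕ j) + shift 2 (row i) (2 * toℕ j) ∎
      where
      Ω-at : Ω R (suc m) x i (combine j 0F) ≡ sgn R (toℕ i ℕ.+ toℕ j) · x i j
      Ω-at rewrite quotRem-combine j 0F = ≡.refl

    ΩEven-coordinates : ∀ i (j : Fin (suc m)) →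
                  ΩEven R (suc m) i j ≈ row i (suc (2 * toℕ j)) + shift 1 (λ k → row i (suc (2 * k))) (toℕ j)
    ΩEven-coordinates i j = begin
      ΩEven R (suc m) i j
        ≡⟨ Ω-at ⟨
      Ω R (suc m) x i (combine j 1F)
        ≈⟨ coordinates i _ ⟩
      row i (toℕ (combine j 1F)) + shift 2 (row i) (toℕ (combine j 1F))
        ≡⟨ ≡.cong (λ n → row i n + shift 2 (row i) n) (toℕ-combine-1F j) ⟩
      row i (suc (2 * toℕ j)) + shift 2 (row i) (suc (2 * toℕ j))
        ≡⟨ ≡.cong (row i (suc (2 * toℕ j)) +_) (shift₂-odd (row i) (toℕ j)) ⟩
      row i (suc (2 * toℕ j)) + shift 1 (λ k → row i (suc (2 * k))) (toℕ j) ∎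
      where
      Ω-at : Ω R (suc m) x i (combine j 1F) ≡ ΩEven R (suc m) i j
      Ω-at rewrite quotRem-combine j 1F = ≡.refl

    oddCoordinate : Fin (suc m) → ℕ → Carrier
    oddCoordinate zero    j = sgn R j
    oddCoordinate (suc k) j = ind R (j ≡ᵇ toℕ k)

    ΩEven-row₀ : ∀ (j : Fin (suc m)) → toℕ j < m → ΩEven R (suc m) zero j ≈ ind R (toℕ j ≡ᵇ 0)
    ΩEven-row₀ j j<m = trans (+-congˡ (trans (*-congʳ (reflexive (ind-< j<m))) (zeroˡ _))) (+-identityʳ _)

    oddCoordinate-consecutive : ∀ i (j : Fin (suc m)) → toℕ j < m →
      oddCoordinate i (toℕ j) + shift 1 (oddCoordinate i) (toℕ j) ≈ ΩEven R (suc m) i j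
    oddCoordinate-consecutive zero    zero    0<m = trans (+-identityʳ 1#) (sym (ΩEven-row₀ zero 0<m))
    oddCoordinate-consecutive zero    (suc j) j<m = trans (-‿inverseˡ _) (sym (ΩEven-row₀ (suc j) j<m))
    oddCoordinate-consecutive (suc k) zero    _   = refl
    oddCoordinate-consecutive (suc k) (suc j) _   = refl

    row-odd : ∀ i j → j < m → row i (suc (2 * j)) ≈ oddCoordinate i j
    row-odd i = consecutive-sums-agree (λ j j<m → fromFin P same-sums j (ℕₚ.m<n⇒m<1+n j<m) j<m)
      where
      o = λ k → row i (suc (2 * k))
      P : ℕ → Set _
      P j = j < m → o j + shift 1 o j ≈ oddCoordinate i j + shift 1 (oddCoordinate i) j
      same-sums : ∀ j → P (toℕ j)
      same-sums j j<m = trans (sym (ΩEven-coordinates i j)) (sym (oddCoordinate-consecutive i j j<m))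

    row-evenSum : ∀ i j → j < m → evenSum (row i) j ≈ signedEntry i (suc j)
    row-evenSum i j j<m = begin
      row i (2 * j) + row i (suc (suc (2 * j)))
        ≈⟨ +-comm _ _ ⟩
      row i (suc (suc (2 * j))) + shift 2 (row i) (suc (suc (2 * j)))
        ≡⟨ ≡.cong (λ n → row i n + shift 2 (row i) n) (ℕₚ.*-suc 2 j) ⟨
      row i (2 * suc j) + shift 2 (row i) (2 * suc j)
        ≈⟨ fromFin (λ k → signedEntry i k ≈ row i (2 * k) + shift 2 (row i) (2 * k))
                   (signedEntry-coordinates i) (suc j) (s≤s j<m) ⟨
      signedEntry i (suc j) ∎

    pairing : Fin (suc m) → Fin (suc m) → Carrier
    pairing i i′ = ∑ℕ m (λ j → signedEntry i (suc j) · oddCoordinate i′ j)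

    pairedForm-rows : ∀ i i′ → pairedForm m (row i) (row i′) ≈ pairing i i′ - pairing i′ i
    pairedForm-rows i i′ = trans
      (∑ℕ-cong m (λ j j<m → +-cong (*-cong (row-evenSum i j j<m) (row-odd i′ j j<m))
                                   (-‿cong (*-cong (row-evenSum i′ j j<m) (row-odd i j j<m)))))
      (∑ℕ-sub m _ _)

    pairing-entry : HasZeroRowSums R x → ∀ i i′ → pairing i i′ ≈ sgn R (toℕ i ℕ.+ toℕ i′) · x i i′
    pairing-entry x-rowSums i zero = begin
      ∑ℕ m (λ j → signedEntry i (suc j) · sgn R j)
        ≈⟨ ∑ℕ-cong m (λ j _ → sign-cancel j) ⟩
      ∑ℕ m (λ j → (- sgn R a) · X (suc j))
        ≈⟨ ∑ℕ-*ˡ m (- sgn R a) _ ⟩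
      (- sgn R a) · ∑ℕ m (λ j → X (suc j))
        ≈⟨ *-congˡ (+-inverseʳ-unique (X 0) _ row-sum) ⟩
      (- sgn R a) · (- X 0)
        ≈⟨ -x·-y≈x·y _ _ ⟩
      sgn R a · x i zero
        ≡⟨ ≡.cong (λ n → sgn R n · x i zero) (ℕₚ.+-identityʳ a) ⟨
      sgn R (a ℕ.+ 0) · x i zero ∎
      where
      a = toℕ i
      X = pad (x i)
      row-sum : X 0 + ∑ℕ m (λ j → X (suc j)) ≈ 0#
      row-sum = trans (sym (sum≈∑ℕ (x i) X (λ k → reflexive (≡.sym (pad-toℕ (x i) k))))) (x-rowSums i)
      sign-cancel : ∀ j → signedEntry i (suc j) · sgn R j ≈ (- sgn R a) · X (suc j)
      sign-cancel j = trans (xy∙z≈xz∙y _ _ _) (*-congʳ (sgn-+-suc-· a j))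
    pairing-entry x-rowSums i (suc k) = begin
      ∑ℕ m (λ j → signedEntry i (suc j) · ind R (j ≡ᵇ toℕ k))
        ≈⟨ ∑ℕ-cong m (λ j _ →
             reflexive (≡.cong (λ b → signedEntry i (suc j) · ind R b) (≡ᵇ-sym j (toℕ k)))) ⟩
      ∑ℕ m (λ j → signedEntry i (suc j) · ind R (toℕ k ≡ᵇ 0 ℕ.+ j))
        ≈⟨ ∑ℕ-δ m 0 (toℕ k) (λ j m≤j →
             trans (*-congˡ (pad-vanishes (x i) (suc j) (s≤s m≤j))) (zeroʳ _)) ⟩
      signedEntry i (toℕ (suc k))
        ≡⟨ ≡.cong (_ ·_) (pad-toℕ (x i) (suc k)) ⟩
      sgn R (toℕ i ℕ.+ toℕ (suc k)) · x i (suc k) ∎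

mainTheorem3 : ∀ {c ℓ} (R : CommutativeRing c ℓ) (m : ℕ)
    (x : Matrix R (suc m) (suc m)) →
    IsSymmetric R x → HasZeroRowSums R x →
    (Ωt : Matrix R (suc m) (2 * m)) → IsCoordinateMatrix R m x Ωt →
    ∀ i j → CommutativeRing._≈_ R ((_⊗_ R (_⊗_ R Ωt (Λ R m)) (_ᵀ R Ωt)) i j) (CommutativeRing.0# R)
mainTheorem3 R m x x-sym x-rowSums Ωt coord i j = begin
  _⊗_ R (_⊗_ R Ωt (Λ R m)) (_ᵀ R Ωt) i j
    ≈⟨ Λ-form R {m = m} Ωt Ωt i j ⟩
  pairedForm R m (row i) (row j)
    ≈⟨ pairedForm-rows i j ⟩
  pairing i j - pairing j i
    ≈⟨ +-cong (pairing-entry x-rowSums i j) (-‿cong (pairing-entry x-rowSums j i)) ⟩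
  sgn R (toℕ i ℕ.+ toℕ j) · x i j - sgn R (toℕ j ℕ.+ toℕ i) · x j i
    ≈⟨ +-congˡ (-‿cong (*-cong (reflexive (≡.cong (sgn R) (ℕₚ.+-comm (toℕ j) (toℕ i)))) (x-sym j i))) ⟩
  sgn R (toℕ i ℕ.+ toℕ j) · x i j - sgn R (toℕ i ℕ.+ toℕ j) · x i j
    ≈⟨ -‿inverseʳ _ ⟩
  0# ∎
  where
  open CommutativeRing R hiding (zero) renaming (_*_ to _·_)
  open SetoidReasoning setoid
  open RowCoordinates R x Ωt coord
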